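{- Every almost-prime number $n>2$ is odd.
   Context: For a positive integer $n$ with positive divisors $1=d_1<d_2<\dots<d_k=n$, define the polynomial $T_n(x)=x^{d_1}+x^{d_2}+\dots+x^{d_k}-kx$. A positive integer $n$ is called weakly almost-prime if $n\mid T_n(x)$ for all integers $x$; it is called almost-prime if it is weakly almost-prime and square-free. -}

module Defs where

open import Data.Nat using (ℕ; suc; _*_)
open import Data.Nat.Divisibility using (_∣_; _∣?_)
open import Data.List using (List; filter; upTo; map; length; sum)
open import Data.Integer as ℤ using (ℤ; +_)
import Data.Integer.Divisibility as ℤD
open import Relation.Binary.PropositionalEquality using (_≡_)
open import Data.Product using (_×_)

divisors : ℕ → List ℕ
divisors n = filter (_∣? n) (map suc (upTo n))

T : ℕ → ℤ → ℤ
T n x = sum' (map (x ℤ.^_) (divisors n)) ℤ.- (+ length (divisors n)) ℤ.* x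
  where
  sum' : List ℤ → ℤ
  sum' = Data.List.foldr ℤ._+_ (+ 0)

WeaklyAlmostPrime : ℕ → Set
WeaklyAlmostPrime n = ∀ (x : ℤ) → (+ n) ℤD.∣ T n x

SquareFree : ℕ → Set
SquareFree n = ∀ (d : ℕ) → d * d ∣ n → d ≡ 1

AlmostPrime : ℕ → Set
AlmostPrime n = WeaklyAlmostPrime n × SquareFree n

-- At x = −1 every divisor d contributes (−1)^d + 1 to T_n(−1), i.e. 2 for even d and 0 for odd d,
-- so T_n(−1) = 2·#{even d ∣ n}.  If n > 2 is even and square-free, then n ∣ T_n(−1) > 0, while
-- bounding the sum by all even d ≤ n except d = 4 (which does not divide n) gives T_n(−1) ≤ n − 2.
module Submission where

open import Defs
open import Data.Nat using (ℕ; _<_)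
open import Data.Nat.Divisibility using (_∣_)
open import Relation.Nullary using (¬_)

open import Data.Nat as ℕ using (zero; suc; _+_; _*_; z<s; _≤_; z≤n; s≤s; NonZero; >-nonZero)
open import Data.Nat.Properties
  using (+-comm; +-assoc; <-≤-trans; m<m+n; +-identityʳ; +-monoˡ-≤; +-monoʳ-≤; m≤m+n; m≤n+m; ≤-refl; ≤-reflexive; ≤-trans; module ≤-Reasoning)
open import Data.Nat.Divisibility using (_∣?_; divides; ∣-refl; ∣⇒≤; >⇒∤; 0∣⇒≡0)
open import Data.Nat.ListAction using (sum)
open import Data.Nat.ListAction.Properties using (sum-++)
open import Data.List using (List; []; _∷_; _∷ʳ_; [_]; filter; upTo; map; length; foldr)
open import Data.List.Properties using (upTo-∷ʳ; map-++)
open import Data.List.Membership.Propositional using (_∈_)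
open import Data.List.Membership.Propositional.Properties using (∈-map⁺; ∈-filter⁺; ∈-upTo⁺)
open import Data.List.Relation.Unary.Any using (here; there)
open import Data.Integer as ℤ using (ℤ; +_; -1ℤ)
open import Data.Integer.Properties as ℤP using (neg-involutive; -1*i≡-i)
open import Algebra.Properties.CommutativeSemigroup ℤP.+-commutativeSemigroup using (interchange)
open import Data.Product using (_,_)
open import Relation.Nullary using (yes; no; contradiction)
open import Relation.Unary using (Pred; Decidable)
open import Relation.Binary.PropositionalEquality using (_≡_; refl; sym; trans; cong; cong₂; subst; module ≡-Reasoning)

module _ {a} {A : Set a} (f : A → ℕ) where

  ∈⇒≤sum-map : ∀ {x xs} → x ∈ xs → f x ≤ sum (map f xs)
  ∈⇒≤sum-map {xs = y ∷ ys} (here refl) = m≤m+n (f y) (sum (map f ys))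
  ∈⇒≤sum-map {xs = y ∷ ys} (there x∈ys) = ≤-trans (∈⇒≤sum-map x∈ys) (m≤n+m _ (f y))

  module _ {p} {P : Pred A p} (P? : Decidable P) where

    sum-map-filter≤ : ∀ xs → sum (map f (filter P? xs)) ≤ sum (map f xs)
    sum-map-filter≤ [] = ≤-refl
    sum-map-filter≤ (y ∷ ys) with P? y
    ... | yes _ = +-monoʳ-≤ (f y) (sum-map-filter≤ ys)
    ... | no  _ = ≤-trans (sum-map-filter≤ ys) (m≤n+m _ (f y))

    sum-map-filter+reject≤ : ∀ {x xs} → x ∈ xs → ¬ P x →
                             sum (map f (filter P? xs)) + f x ≤ sum (map f xs)
    sum-map-filter+reject≤ {x} {y ∷ ys} (here refl) ¬Px with P? y
    ... | yes Px = contradiction Px ¬Px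
    ... | no  _  = ≤-trans (≤-reflexive (+-comm _ (f x))) (+-monoʳ-≤ (f x) (sum-map-filter≤ ys))
    sum-map-filter+reject≤ {x} {y ∷ ys} (there x∈ys) ¬Px with P? y
    ... | yes _ = ≤-trans (≤-reflexive (+-assoc (f y) _ (f x)))
                          (+-monoʳ-≤ (f y) (sum-map-filter+reject≤ x∈ys ¬Px))
    ... | no  _ = ≤-trans (sum-map-filter+reject≤ x∈ys ¬Px) (m≤n+m _ (f y))

evenWeight : ℕ → ℕ
evenWeight zero = 2
evenWeight (suc zero) = 0
evenWeight (suc (suc d)) = evenWeight d

evenWeight-even : ∀ {d} → 2 ∣ d → evenWeight d ≡ 2
evenWeight-even (divides q refl) = go q
  where
  go : ∀ q → evenWeight (q * 2) ≡ 2
  go zero = refl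
  go (suc q) = go q

evenWeight-consecutive : ∀ d → evenWeight d + evenWeight (suc d) ≡ 2
evenWeight-consecutive zero = refl
evenWeight-consecutive (suc zero) = refl
evenWeight-consecutive (suc (suc d)) = evenWeight-consecutive d

-1^d+1≡evenWeight : ∀ d → -1ℤ ℤ.^ d ℤ.+ + 1 ≡ + evenWeight d
-1^d+1≡evenWeight zero = refl
-1^d+1≡evenWeight (suc zero) = refl
-1^d+1≡evenWeight (suc (suc d)) = trans (cong (ℤ._+ + 1) -1^2+d≡-1^d) (-1^d+1≡evenWeight d)
  where
  -1^2+d≡-1^d : -1ℤ ℤ.^ suc (suc d) ≡ -1ℤ ℤ.^ d
  -1^2+d≡-1^d = begin
    -1ℤ ℤ.* (-1ℤ ℤ.* (-1ℤ ℤ.^ d)) ≡⟨ -1*i≡-i _ ⟩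
    ℤ.- (-1ℤ ℤ.* (-1ℤ ℤ.^ d))      ≡⟨ cong ℤ.-_ (-1*i≡-i _) ⟩
    ℤ.- ℤ.- (-1ℤ ℤ.^ d)            ≡⟨ neg-involutive _ ⟩
    -1ℤ ℤ.^ d                      ∎
    where open ≡-Reasoning

weightSum : List ℕ → ℕ
weightSum xs = sum (map evenWeight xs)

sum-map-[-1]^+length : ∀ xs → foldr ℤ._+_ (+ 0) (map (-1ℤ ℤ.^_) xs) ℤ.+ + length xs ≡ + weightSum xs
sum-map-[-1]^+length [] = refl
sum-map-[-1]^+length (d ∷ ds) =
  trans (interchange (-1ℤ ℤ.^ d) (foldr ℤ._+_ (+ 0) (map (-1ℤ ℤ.^_) ds)) (+ 1) (+ length ds))
        (cong₂ ℤ._+_ (-1^d+1≡evenWeight d) (sum-map-[-1]^+length ds))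

T[-1]≡weightSum : ∀ n → T n -1ℤ ≡ + weightSum (divisors n)
T[-1]≡weightSum n = begin
  s ℤ.- + k ℤ.* -1ℤ   ≡⟨ cong (λ z → s ℤ.- z) (trans (ℤP.*-comm (+ k) -1ℤ) (-1*i≡-i (+ k))) ⟩
  s ℤ.+ ℤ.- ℤ.- + k   ≡⟨ cong (λ z → s ℤ.+ z) (neg-involutive (+ k)) ⟩
  s ℤ.+ + k           ≡⟨ sum-map-[-1]^+length (divisors n) ⟩
  + weightSum (divisors n) ∎
  where
  open ≡-Reasoning
  s : ℤ
  s = foldr ℤ._+_ (+ 0) (map (-1ℤ ℤ.^_) (divisors n))
  k : ℕ
  k = length (divisors n)

oneTo : ℕ → List ℕ
oneTo m = map suc (upTo m)

∈-oneTo⁺ : ∀ {d m} → .{{NonZero d}} → d ≤ m → d ∈ oneTo m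
∈-oneTo⁺ {suc k} k<m = ∈-map⁺ suc (∈-upTo⁺ k<m)

∈-divisors⁺ : ∀ {d n} → .{{NonZero n}} → d ∣ n → d ∈ divisors n
∈-divisors⁺ {zero} {suc _} 0∣n with () ← 0∣⇒≡0 0∣n
∈-divisors⁺ {suc _} d∣n = ∈-filter⁺ (_∣? _) (∈-oneTo⁺ (∣⇒≤ d∣n)) d∣n

weightSum-oneTo-suc : ∀ m → weightSum (oneTo (suc m)) ≡ weightSum (oneTo m) + evenWeight (suc m)
weightSum-oneTo-suc m = begin
  weightSum (map suc (upTo (suc m)))                 ≡⟨ cong (λ xs → weightSum (map suc xs)) (sym (upTo-∷ʳ m)) ⟩
  weightSum (map suc (upTo m ∷ʳ m))                  ≡⟨ cong weightSum (map-++ suc (upTo m) [ m ]) ⟩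
  weightSum (oneTo m ∷ʳ suc m)                        ≡⟨ cong sum (map-++ evenWeight (oneTo m) [ suc m ]) ⟩
  sum (map evenWeight (oneTo m) ∷ʳ evenWeight (suc m)) ≡⟨ sum-++ (map evenWeight (oneTo m)) _ ⟩
  weightSum (oneTo m) + (evenWeight (suc m) + 0)      ≡⟨ cong (weightSum (oneTo m) ℕ.+_) (+-identityʳ _) ⟩
  weightSum (oneTo m) + evenWeight (suc m)            ∎
  where open ≡-Reasoning

weightSum-oneTo≤ : ∀ m → weightSum (oneTo m) ≤ m
weightSum-oneTo≤ zero = z≤n
weightSum-oneTo≤ (suc zero) = z≤n
weightSum-oneTo≤ (suc (suc m)) = begin
  weightSum (oneTo (2 + m))                                        ≡⟨ weightSum-oneTo-suc (suc m) ⟩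
  weightSum (oneTo (1 + m)) + evenWeight (2 + m)                   ≡⟨ cong (_+ evenWeight (2 + m)) (weightSum-oneTo-suc m) ⟩
  weightSum (oneTo m) + evenWeight (1 + m) + evenWeight (2 + m)    ≡⟨ +-assoc (weightSum (oneTo m)) _ _ ⟩
  weightSum (oneTo m) + (evenWeight (1 + m) + evenWeight (2 + m))  ≡⟨ cong (weightSum (oneTo m) ℕ.+_) (evenWeight-consecutive (suc m)) ⟩
  weightSum (oneTo m) + 2                                          ≤⟨ +-monoˡ-≤ 2 (weightSum-oneTo≤ m) ⟩
  m + 2                                                            ≡⟨ +-comm m 2 ⟩
  2 + m                                                            ∎
  where open ≤-Reasoning

weightSum-divisors≥2 : ∀ {n} → .{{NonZero n}} → 2 ∣ n → 2 ≤ weightSum (divisors n)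
weightSum-divisors≥2 {n} 2∣n =
  subst (_≤ weightSum (divisors n)) (evenWeight-even 2∣n) (∈⇒≤sum-map evenWeight (∈-divisors⁺ (∣-refl {n})))

weightSum-divisors+2≤ : ∀ {n} → 4 ≤ n → ¬ (4 ∣ n) → weightSum (divisors n) + 2 ≤ n
weightSum-divisors+2≤ {n} 4≤n 4∤n = begin
  weightSum (divisors n) + evenWeight 4 ≤⟨ sum-map-filter+reject≤ evenWeight (_∣? n) (∈-oneTo⁺ 4≤n) 4∤n ⟩
  weightSum (oneTo n)                   ≤⟨ weightSum-oneTo≤ n ⟩
  n                                     ∎
  where open ≤-Reasoning

even>2⇒≥4 : ∀ {n} → 2 ∣ n → 2 < n → 4 ≤ n
even>2⇒≥4 (divides (suc (suc q)) refl) _ = s≤s (s≤s (s≤s (s≤s z≤n)))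
even>2⇒≥4 (divides (suc zero) refl) (s≤s (s≤s ()))

corollary2p5 : ∀ (n : ℕ) → AlmostPrime n → 2 < n → ¬ (2 ∣ n)
corollary2p5 zero _ () _
corollary2p5 n@(suc _) (weaklyAlmostPrime , squareFree) 2<n 2∣n =
  >⇒∤ {{>-nonZero W>0}} W<n n∣W
  where
  W : ℕ
  W = weightSum (divisors n)
  n∣W : n ∣ W
  n∣W = subst (λ t → n ∣ ℤ.∣ t ∣) (T[-1]≡weightSum n) (weaklyAlmostPrime -1ℤ)
  4∤n : ¬ (4 ∣ n)
  4∤n 4∣n with () ← squareFree 2 4∣n
  W>0 : 0 < W
  W>0 = ≤-trans (s≤s z≤n) (weightSum-divisors≥2 2∣n)
  W<n : W < n
  W<n = <-≤-trans (m<m+n W z<s) (weightSum-divisors+2≤ (even>2⇒≥4 2∣n 2<n) 4∤n)
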